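{- Let $\vec{c}=(c_1,\dots,c_k)$ be a pointed composition of $n$ with $k\ge 2$ and $c_k=0$. Then the simplicial complex $\Delta_{\vec{c}}$ is a cone over the complex $\Delta_{(c_1,\dots,c_{k-1})}$ with apex the vertex $([n],\emptyset)$, and hence $\Delta_{\vec{c}}$ is contractible.
   Context: A pointed composition of $n$ is a sequence $(c_1,\dots,c_k)$ of integers with $c_1,\dots,c_{k-1}\ge 1$, $c_k\ge 0$ and $c_1+\dots+c_k=n$. Pointed compositions of $n$ are partially ordered by: $\vec c\le\vec d$ iff $\vec d$ is obtained from $\vec c$ by replacing runs of consecutive entries by their sums (the cover relation is $(c_1,\dots,c_i,c_{i+1},\dots,c_k)\prec(c_1,\dots,c_i+c_{i+1},\dots,c_k)$). An ordered set partition of $[n]=\{1,\dots,n\}$ is a list $(C_1,\dots,C_m)$ of pairwise disjoint subsets of $[n]$ with union $[n]$, where $C_1,\dots,C_{m-1}$ are nonempty and $C_m$ may be empty; its type is the pointed composition $(|C_1|,\dots,|C_m|)$. The simplicial complex $\Delta_n$ has these ordered set partitions as faces: $(C_1,\dots,C_m)$ is a face of dimension $m-2$, its faces are the ordered set partitions obtained by merging consecutive blocks, and $([n])$ is the empty face; vertices are the $(C_1,C_2)$ with $C_1\neq\emptyset$. (Equivalently, $\Delta_n$ is the order complex of the poset of nonempty subsets of $[n]$ under inclusion, the chain $S_1\subset\dots\subset S_{m-1}$ corresponding to $(S_1,S_2\setminus S_1,\dots,[n]\setminus S_{m-1})$.) For a pointed composition $\vec c$ of $n$, $\Delta_{\vec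 c}=\{\tau\in\Delta_n:\vec c\le\operatorname{type}(\tau)\}$, a subcomplex of $\Delta_n$; for $(c_1,\dots,c_{k-1})$ (a composition of $n$) the complex $\Delta_{(c_1,\dots,c_{k-1})}$ is defined likewise inside $\Delta_n$. -}

module Defs where

open import Data.Nat using (ℕ; zero; suc; _≤_)
open import Data.List using (List; []; _∷_; _++_; map; foldr)
open import Data.Nat.ListAction using (sum)
open import Data.List.Relation.Unary.All using (All)
open import Data.List.Relation.Unary.AllPairs using (AllPairs)
open import Data.List.Membership.Propositional using (_∈_)
open import Data.Fin.Subset using (Subset; ⊤; ⊥; _∪_; _∩_; ∣_∣; Nonempty)
open import Data.Product using (Σ; ∃; _×_; _,_)
open import Data.Sum using (_⊎_)
open import Data.Unit using () renaming (⊤ to Unit)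
open import Data.Empty using () renaming (⊥ to Empty)
open import Relation.Nullary using (¬_)
open import Relation.Binary.PropositionalEquality using (_≡_)
open import Function.Bundles using (_⇔_)

AllButLastPos : List ℕ → Set
AllButLastPos []           = Unit
AllButLastPos (x ∷ [])     = Unit
AllButLastPos (x ∷ y ∷ xs) = (1 ≤ x) × AllButLastPos (y ∷ xs)

PointedComposition : ℕ → List ℕ → Set
PointedComposition n []       = Empty
PointedComposition n (x ∷ xs) = AllButLastPos (x ∷ xs) × sum (x ∷ xs) ≡ n

-- c ≼ d : d is obtained from c by replacing consecutive runs of entries
-- by their sums (c is cut into consecutive nonempty runs, each summed)
data _≼_ : List ℕ → List ℕ → Set where
  done  : [] ≼ []
  merge : ∀ {c d} (x : ℕ) (r : List ℕ) → c ≼ d →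
          (x ∷ r ++ c) ≼ (sum (x ∷ r) ∷ d)

AllButLastNonempty : ∀ {n} → List (Subset n) → Set
AllButLastNonempty []           = Unit
AllButLastNonempty (B ∷ [])     = Unit
AllButLastNonempty (B ∷ B' ∷ Bs) = Nonempty B × AllButLastNonempty (B' ∷ Bs)

Disjoint : ∀ {n} → Subset n → Subset n → Set
Disjoint B B' = B ∩ B' ≡ ⊥

record IsOSP {n : ℕ} (Bs : List (Subset n)) : Set where
  field
    nonemptyList : ¬ (Bs ≡ [])
    disjoint     : AllPairs Disjoint Bs
    covers       : foldr _∪_ ⊥ Bs ≡ ⊤
    blocks       : AllButLastNonempty Bs

-- faces of Δ_n : ordered set partitions (C₁,…,C_m) of [n]
Face : ℕ → Set
Face n = Σ (List (Subset n)) IsOSP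

blocksOf : ∀ {n} → Face n → List (Subset n)
blocksOf (Bs , _) = Bs

type : ∀ {n} → Face n → List ℕ
type τ = map ∣_∣ (blocksOf τ)

Δ : ∀ {n} → List ℕ → Face n → Set
Δ c τ = c ≼ type τ

-- Vertices.  The vertex (A, [n] ∖ A) (A nonempty) is identified with A;
-- the vertices of the face (C₁,…,C_m) are C₁ ∪ … ∪ C_i for 1 ≤ i ≤ m-1.

prefixUnions : ∀ {n} → List (Subset n) → List (Subset n)
prefixUnions []            = []
prefixUnions (B ∷ [])      = []
prefixUnions (B ∷ B' ∷ Bs) = B ∷ map (B ∪_) (prefixUnions (B' ∷ Bs))

vertices : ∀ {n} → Face n → List (Subset n)
vertices τ = prefixUnions (blocksOf τ)

_≐_ : ∀ {n} → List (Subset n) → List (Subset n) → Set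
xs ≐ ys = ∀ A → (A ∈ xs) ⇔ (A ∈ ys)

-- K is a cone over L with apex v (faces of Δ_n identified with their
-- vertex sets): v is a vertex of K but of no face of L, L ⊆ K, σ ∪ {v}
-- is a face of K for every face σ of L, and every face of K is of the
-- form σ or σ ∪ {v} with σ a face of L.

record IsConeOver {n : ℕ} (K L : Face n → Set) (v : Subset n) : Set where
  field
    apex-vertex : ∃ λ τ → K τ × (vertices τ ≐ (v ∷ []))
    apex-notin  : ∀ σ → L σ → ¬ (v ∈ vertices σ)
    L⊆K         : ∀ σ → L σ → K σ
    join        : ∀ σ → L σ → ∃ λ τ → K τ × (vertices τ ≐ (v ∷ vertices σ))
    covered     : ∀ τ → K τ → ∃ λ σ → L σ ×
                    ((vertices τ ≐ vertices σ) ⊎ (vertices τ ≐ (v ∷ vertices σ)))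

module Submission where

-- Ordered set partitions ending in an empty block correspond exactly to
-- the faces σ * apex: appending the empty block ∅ to σ = (C₁,…,C_m) adds
-- the single vertex C₁ ∪ … ∪ C_m = [n] to its vertex set.  The proof
-- therefore splits into three independent parts:
--   * compositions: for a composition c (entries ≥ 1), c ∷ʳ 0 ≼ e holds
--     iff either e = d ∷ʳ 0 with c ≼ d (the 0 is a run of its own), or
--     c ≼ e (the 0 was absorbed into the last run); see `lastZero`;
--   * faces: appending/removing an empty last block preserves being an
--     ordered set partition when all blocks are nonempty, which every face
--     of Δ_c has because c is positive;
--   * vertices: the vertices of Bs ∷ʳ X are those of Bs together with ⋃ Bs,
--     and [n] is never a vertex of a face with nonempty last block.
-- The apex itself is the cone over the empty face ([n]) of Δ_c.

open import Defs
open import Data.Nat using (ℕ; _+_; _≤_)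
open import Data.Nat.Properties using (≤-trans; m≤m+n; +-identityʳ)
open import Data.Nat.ListAction using (sum)
open import Data.Nat.ListAction.Properties using (sum-++)
open import Data.List using (List; []; _∷_; _++_; map; foldr; _∷ʳ_; initLast; _∷ʳ′_)
open import Data.List.Properties using (++-assoc; ++-identityʳ; ++-conicalʳ; map-++; foldr-∷ʳ; ∷ʳ-injective)
open import Data.List.Relation.Unary.All using (All; []; _∷_; universal)
open import Data.List.Relation.Unary.All.Properties using (++⁻ˡ; ++⁻ʳ; ∷ʳ⁻; map⁻)
import Data.List.Relation.Unary.All as All
open import Data.List.Relation.Unary.AllPairs using (AllPairs; []; _∷_)
import Data.List.Relation.Unary.AllPairs.Properties as AllPairs
import Data.List.Relation.Unary.Any as Any
open import Data.List.Membership.Propositional using (_∈_; _∉_)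
open import Data.List.Membership.Propositional.Properties using (∈-map⁻)
open import Data.List.Relation.Binary.Permutation.Propositional
  using (_↭_; ↭-refl; ↭-sym; ↭-trans; ↭-reflexive; module PermutationReasoning)
open import Data.List.Relation.Binary.Permutation.Propositional.Properties using (∈-resp-↭; ++-comm)
open import Data.Fin using (zero; suc)
open import Data.Fin.Subset using (Subset; ⊤; ⊥; _∪_; _∩_; ∣_∣; Nonempty; inside; outside)
  renaming (_∈_ to _∈ₛ_)
open import Data.Fin.Subset.Properties using (∪-identityʳ; ∩-zeroʳ; ∩-identityˡ; ∩-distribʳ-∪; ∉⊥; ∣⊥∣≡0; ∣⊤∣≡n)
open import Data.Vec using (_∷_; [])
open import Data.Vec.Base using (here; there)
open import Data.Product using (∃; _×_; _,_; proj₁; proj₂)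
open import Data.Sum using (_⊎_; inj₁; inj₂)
open import Data.Unit using (tt)
open import Relation.Nullary using (¬_; contradiction)
open import Relation.Binary.PropositionalEquality
  using (_≡_; _≢_; refl; sym; trans; cong; cong₂; subst; module ≡-Reasoning)
open import Function.Bundles using (mk⇔)

sum-∷ʳ0 : ∀ c → sum (c ∷ʳ 0) ≡ sum c
sum-∷ʳ0 c = trans (sum-++ c (0 ∷ [])) (+-identityʳ (sum c))

≼-whole : ∀ {c} → c ≢ [] → c ≼ (sum c ∷ [])
≼-whole {[]}    c≢[] = contradiction refl c≢[]
≼-whole {x ∷ r} _    = subst (λ l → (x ∷ l) ≼ (sum (x ∷ r) ∷ [])) (++-identityʳ r) (merge x r done)

≼-++ : ∀ {c d c′ d′} → c ≼ d → c′ ≼ d′ → (c ++ c′) ≼ (d ++ d′)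
≼-++ done p′ = p′
≼-++ {c′ = c′} (merge {c} x r p) p′ =
  subst (λ l → (x ∷ l) ≼ _) (sym (++-assoc r c c′)) (merge x r (≼-++ p p′))

≼-absorb0 : ∀ {c d} → c ≼ d → c ≢ [] → (c ∷ʳ 0) ≼ d
≼-absorb0 done c≢[] = contradiction refl c≢[]
≼-absorb0 (merge {[]} x r done) _ =
  subst (λ s → (x ∷ (r ++ []) ∷ʳ 0) ≼ (x + s ∷ [])) sum-r0≡sum-r (≼-whole {x ∷ (r ++ []) ∷ʳ 0} (λ ()))
  where
    sum-r0≡sum-r : sum ((r ++ []) ∷ʳ 0) ≡ sum r
    sum-r0≡sum-r = trans (sum-∷ʳ0 (r ++ [])) (cong sum (++-identityʳ r))
≼-absorb0 (merge {y ∷ ys} x r p) _ =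
  subst (λ l → (x ∷ l) ≼ _) (sym (++-assoc r (y ∷ ys) (0 ∷ []))) (merge x r (≼-absorb0 p (λ ())))

≼-nonempty : ∀ {c d} → c ≼ d → c ≢ [] → d ≢ []
≼-nonempty done         c≢[] = c≢[]
≼-nonempty (merge _ _ _) _   = λ ()

-- Sums of positive entries are positive, so positivity goes up along ≼.
≼-positive : ∀ {c d} → c ≼ d → All (1 ≤_) c → All (1 ≤_) d
≼-positive done [] = []
≼-positive (merge x r p) (1≤x ∷ pos) = ≤-trans 1≤x (m≤m+n x (sum r)) ∷ ≼-positive p (++⁻ʳ r pos)

init-positive : ∀ c {z} → AllButLastPos (c ∷ʳ z) → All (1 ≤_) c
init-positive []           _           = []
init-positive (x ∷ [])     (1≤x , _)   = 1≤x ∷ []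
init-positive (x ∷ y ∷ ys) (1≤x , pos) = 1≤x ∷ init-positive (y ∷ ys) pos

pointed-∷ʳ0 : ∀ n c → PointedComposition n (c ∷ʳ 0) → All (1 ≤_) c × sum c ≡ n
pointed-∷ʳ0 n []      (_ , Σ≡n)     = [] , Σ≡n
pointed-∷ʳ0 n (x ∷ r) (shape , Σ≡n) =
  init-positive (x ∷ r) shape , trans (sym (sum-∷ʳ0 (x ∷ r))) Σ≡n

-- The two ways a coarsening e of c ∷ʳ 0 can treat the trailing zero.
data LastZero (c e : List ℕ) : Set where
  own-run  : ∀ d → e ≡ d ∷ʳ 0 → c ≼ d → LastZero c e
  absorbed : c ≼ e → LastZero c e

LastZero-merge : ∀ x r {c d} → LastZero c d → LastZero (x ∷ r ++ c) (sum (x ∷ r) ∷ d)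
LastZero-merge x r (own-run d refl q) = own-run (sum (x ∷ r) ∷ d) refl (merge x r q)
LastZero-merge x r (absorbed q)       = absorbed (merge x r q)

lastZero-final : ∀ c xs → xs ≡ c ∷ʳ 0 → LastZero c (sum xs ∷ [])
lastZero-final []       _ refl = own-run [] refl done
lastZero-final (y ∷ ys) _ refl =
  absorbed (subst (λ s → (y ∷ ys) ≼ (s ∷ [])) (sym (sum-∷ʳ0 (y ∷ ys))) (≼-whole (λ ())))

-- Inversion of c ∷ʳ 0 ≼ e, by induction on the runs of e: only the last
-- run (c₀ = []) can contain the trailing 0.
lastZero : ∀ {c′ e} → c′ ≼ e → ∀ c → c′ ≡ c ∷ʳ 0 → LastZero c e
lastZero done c eq with () ← ++-conicalʳ c (0 ∷ []) (sym eq)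
lastZero (merge {c₀} x r p) c eq with initLast c₀
lastZero (merge x r done) c eq | [] =
  lastZero-final c (x ∷ r) (trans (cong (x ∷_) (sym (++-identityʳ r))) eq)
... | c₁ ∷ʳ′ z
  with refl , refl ← ∷ʳ-injective (x ∷ r ++ c₁) c (trans (++-assoc (x ∷ r) c₁ (z ∷ [])) eq) =
  LastZero-merge x r (lastZero p c₁ refl)

∣p∣≡0⇒p≡⊥ : ∀ {n} (p : Subset n) → ∣ p ∣ ≡ 0 → p ≡ ⊥
∣p∣≡0⇒p≡⊥ []            _   = refl
∣p∣≡0⇒p≡⊥ (outside ∷ p) eq  = cong (outside ∷_) (∣p∣≡0⇒p≡⊥ p eq)
∣p∣≡0⇒p≡⊥ (inside ∷ p)  ()

1≤∣p∣⇒nonempty : ∀ {n} (p : Subset n) → 1 ≤ ∣ p ∣ → Nonempty p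
1≤∣p∣⇒nonempty (inside ∷ p)  _ = zero , here
1≤∣p∣⇒nonempty (outside ∷ p) h with i , i∈p ← 1≤∣p∣⇒nonempty p h = suc i , there i∈p

∪-disjoint : ∀ {n} {A A′ L : Subset n} → Disjoint A L → Disjoint A′ L → Disjoint (A ∪ A′) L
∪-disjoint {A = A} {A′} {L} A∩L≡⊥ A′∩L≡⊥ = begin
  (A ∪ A′) ∩ L        ≡⟨ ∩-distribʳ-∪ L A A′ ⟩
  (A ∩ L) ∪ (A′ ∩ L)  ≡⟨ cong₂ _∪_ A∩L≡⊥ A′∩L≡⊥ ⟩
  ⊥ ∪ ⊥               ≡⟨ ∪-identityʳ ⊥ ⟩
  ⊥                   ∎
  where open ≡-Reasoning

AllPairs-++⁻ˡ : ∀ {A : Set} {R : A → A → Set} xs {ys} → AllPairs R (xs ++ ys) → AllPairs R xs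
AllPairs-++⁻ˡ []       _        = []
AllPairs-++⁻ˡ (x ∷ xs) (r ∷ rs) = ++⁻ˡ xs r ∷ AllPairs-++⁻ˡ xs rs

module _ {n : ℕ} where

  Blocks : Set
  Blocks = List (Subset n)

  ⋃ : Blocks → Subset n
  ⋃ = foldr _∪_ ⊥

  ⋃-∷ʳ⊥ : ∀ (Bs : Blocks) → ⋃ (Bs ∷ʳ ⊥) ≡ ⋃ Bs
  ⋃-∷ʳ⊥ Bs = trans (foldr-∷ʳ _∪_ ⊥ ⊥ Bs) (cong (λ U → foldr _∪_ U Bs) (∪-identityʳ ⊥))

  nonempty⇒blocks : ∀ (Bs : Blocks) → All Nonempty Bs → AllButLastNonempty Bs
  nonempty⇒blocks []            _          = tt
  nonempty⇒blocks (B ∷ [])      _          = tt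
  nonempty⇒blocks (B ∷ B′ ∷ Bs) (ne ∷ nes) = ne , nonempty⇒blocks (B′ ∷ Bs) nes

  nonempty⇒blocks-∷ʳ : ∀ (Bs : Blocks) {X} → All Nonempty Bs → AllButLastNonempty (Bs ∷ʳ X)
  nonempty⇒blocks-∷ʳ []            _          = tt
  nonempty⇒blocks-∷ʳ (B ∷ [])      (ne ∷ [])  = ne , tt
  nonempty⇒blocks-∷ʳ (B ∷ B′ ∷ Bs) (ne ∷ nes) = ne , nonempty⇒blocks-∷ʳ (B′ ∷ Bs) nes

  IsOSP-∷ʳ⊥ : ∀ {Bs : Blocks} → IsOSP Bs → All Nonempty Bs → IsOSP (Bs ∷ʳ ⊥)
  IsOSP-∷ʳ⊥ {Bs} o nes = record
    { nonemptyList = λ eq → contradiction (++-conicalʳ Bs (⊥ ∷ []) eq) (λ ())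
    ; disjoint     = AllPairs.++⁺ (IsOSP.disjoint o) ([] ∷ []) (universal (λ B → ∩-zeroʳ B ∷ []) Bs)
    ; covers       = trans (⋃-∷ʳ⊥ Bs) (IsOSP.covers o)
    ; blocks       = nonempty⇒blocks-∷ʳ Bs nes
    }

  IsOSP-∷ʳ⊥⁻ : ∀ {Bs : Blocks} → Bs ≢ [] → All Nonempty Bs → IsOSP (Bs ∷ʳ ⊥) → IsOSP Bs
  IsOSP-∷ʳ⊥⁻ {Bs} Bs≢[] nes o = record
    { nonemptyList = Bs≢[]
    ; disjoint     = AllPairs-++⁻ˡ Bs (IsOSP.disjoint o)
    ; covers       = trans (sym (⋃-∷ʳ⊥ Bs)) (IsOSP.covers o)
    ; blocks       = nonempty⇒blocks Bs nes
    }

  type-∷ʳ⊥ : ∀ (Bs : Blocks) → map ∣_∣ (Bs ∷ʳ ⊥) ≡ map ∣_∣ Bs ∷ʳ 0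
  type-∷ʳ⊥ Bs = trans (map-++ ∣_∣ Bs (⊥ ∷ [])) (cong (map ∣_∣ Bs ∷ʳ_) (∣⊥∣≡0 n))

  type≡∷ʳ0 : ∀ (Bs : Blocks) d → map ∣_∣ Bs ≡ d ∷ʳ 0 → ∃ λ Bs′ → Bs ≡ Bs′ ∷ʳ ⊥ × map ∣_∣ Bs′ ≡ d
  type≡∷ʳ0 Bs d eq with initLast Bs
  ... | [] with () ← ++-conicalʳ d (0 ∷ []) (sym eq)
  ... | Bs′ ∷ʳ′ B
    with e , ∣B∣≡0 ← ∷ʳ-injective (map ∣_∣ Bs′) d (trans (sym (map-++ ∣_∣ Bs′ (B ∷ []))) eq) =
    Bs′ , cong (Bs′ ∷ʳ_) (∣p∣≡0⇒p≡⊥ B ∣B∣≡0) , e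

  positive⇒nonempty : ∀ {Bs : Blocks} → All (1 ≤_) (map ∣_∣ Bs) → All Nonempty Bs
  positive⇒nonempty pos = All.map (λ {B} → 1≤∣p∣⇒nonempty B) (map⁻ pos)

  ↭⇒≐ : ∀ {xs ys : Blocks} → xs ↭ ys → xs ≐ ys
  ↭⇒≐ p A = mk⇔ (∈-resp-↭ p) (∈-resp-↭ (↭-sym p))

  prefixUnions-∷ʳ : ∀ B (Bs : Blocks) X → prefixUnions ((B ∷ Bs) ∷ʳ X) ≡ prefixUnions (B ∷ Bs) ∷ʳ ⋃ (B ∷ Bs)
  prefixUnions-∷ʳ B []        X = cong (_∷ []) (sym (∪-identityʳ B))
  prefixUnions-∷ʳ B (B′ ∷ Bs) X = cong (B ∷_) (begin
    map (B ∪_) (prefixUnions ((B′ ∷ Bs) ∷ʳ X))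
      ≡⟨ cong (map (B ∪_)) (prefixUnions-∷ʳ B′ Bs X) ⟩
    map (B ∪_) (prefixUnions (B′ ∷ Bs) ∷ʳ ⋃ (B′ ∷ Bs))
      ≡⟨ map-++ (B ∪_) (prefixUnions (B′ ∷ Bs)) (⋃ (B′ ∷ Bs) ∷ []) ⟩
    map (B ∪_) (prefixUnions (B′ ∷ Bs)) ∷ʳ ⋃ (B ∷ B′ ∷ Bs) ∎)
    where open ≡-Reasoning

  vertices-∷ʳ : ∀ {Bs : Blocks} X → IsOSP Bs → prefixUnions (Bs ∷ʳ X) ≐ (⊤ ∷ prefixUnions Bs)
  vertices-∷ʳ {[]}     X o = contradiction refl (IsOSP.nonemptyList o)
  vertices-∷ʳ {B ∷ Bs} X o = ↭⇒≐ (↭-trans (↭-reflexive (prefixUnions-∷ʳ B Bs X)) (begin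
    prefixUnions (B ∷ Bs) ++ ⋃ (B ∷ Bs) ∷ [] ↭⟨ ++-comm (prefixUnions (B ∷ Bs)) (⋃ (B ∷ Bs) ∷ []) ⟩
    ⋃ (B ∷ Bs) ∷ prefixUnions (B ∷ Bs)      ≡⟨ cong (_∷ prefixUnions (B ∷ Bs)) (IsOSP.covers o) ⟩
    ⊤ ∷ prefixUnions (B ∷ Bs)               ∎))
    where open PermutationReasoning

  vertex-disjoint-last : ∀ (Is : Blocks) L {A} → AllPairs Disjoint (Is ∷ʳ L) →
                         A ∈ prefixUnions (Is ∷ʳ L) → Disjoint A L
  vertex-disjoint-last []           L _                   ()
  vertex-disjoint-last (I ∷ [])     L ((I∩L ∷ []) ∷ _)    (Any.here refl) = I∩L
  vertex-disjoint-last (I ∷ [])     L _                   (Any.there ())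
  vertex-disjoint-last (I ∷ J ∷ Js) L (I∩Js,L ∷ _)        (Any.here refl) =
    proj₂ (∷ʳ⁻ {xs = J ∷ Js} I∩Js,L)
  vertex-disjoint-last (I ∷ J ∷ Js) L (I∩Js,L ∷ disj)     (Any.there A∈)
    with A′ , A′∈ , refl ← ∈-map⁻ (I ∪_) A∈ =
    ∪-disjoint (proj₂ (∷ʳ⁻ {xs = J ∷ Js} I∩Js,L)) (vertex-disjoint-last (J ∷ Js) L disj A′∈)

  -- [n] is not a vertex of a partition with nonempty blocks: it would meet the last block.
  ⊤-not-vertex : ∀ (Bs : Blocks) → AllPairs Disjoint Bs → All Nonempty Bs → ⊤ ∉ prefixUnions Bs
  ⊤-not-vertex Bs disj nes with initLast Bs
  ... | []       = λ ()
  ... | Is ∷ʳ′ L with i , i∈L ← proj₂ (∷ʳ⁻ nes) = λ ⊤∈ →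
    ∉⊥ (subst (i ∈ₛ_) (trans (sym (∩-identityˡ L)) (vertex-disjoint-last Is L disj ⊤∈)) i∈L)

module Cone {n : ℕ} (c : List ℕ) (c≢[] : c ≢ []) (c-pos : All (1 ≤_) c) where

  -- Faces of Δ_c have only nonempty blocks, since every entry of c is ≥ 1.
  Δ-nonempty : ∀ (σ : Face n) → Δ c σ → All Nonempty (blocksOf σ)
  Δ-nonempty σ l = positive⇒nonempty (≼-positive l c-pos)

  -- σ * apex = σ ∷ʳ ∅ lies in Δ_{c ∷ʳ 0} and has vertex set {[n]} ∪ vertices σ.
  cone-join : ∀ (σ : Face n) → Δ c σ → ∃ λ τ → Δ (c ∷ʳ 0) τ × (vertices τ ≐ (⊤ ∷ vertices σ))
  cone-join σ@(Bs , o) l =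
    (Bs ∷ʳ ⊥ , IsOSP-∷ʳ⊥ o (Δ-nonempty σ l)) ,
    subst ((c ∷ʳ 0) ≼_) (sym (type-∷ʳ⊥ Bs)) (≼-++ l (merge 0 [] done)) ,
    vertices-∷ʳ ⊥ o

  cone-apex-notin : ∀ (σ : Face n) → Δ c σ → ¬ (⊤ ∈ vertices σ)
  cone-apex-notin σ@(Bs , o) l = ⊤-not-vertex Bs (IsOSP.disjoint o) (Δ-nonempty σ l)

  -- The empty face ([n]) of Δ_n, which lies in Δ_c when c is a composition of n.
  empty-face : Face n
  empty-face = ⊤ ∷ [] , record
    { nonemptyList = λ ()
    ; disjoint     = [] ∷ []
    ; covers       = ∪-identityʳ ⊤
    ; blocks       = tt
    }

  empty-face∈Δ : sum c ≡ n → Δ c empty-face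
  empty-face∈Δ Σc≡n = subst (λ k → c ≼ (k ∷ [])) (trans Σc≡n (sym (∣⊤∣≡n n))) (≼-whole c≢[])

  -- The apex ([n], ∅) is the cone over the empty face.
  cone-apex : sum c ≡ n → ∃ λ τ → Δ (c ∷ʳ 0) τ × (vertices τ ≐ (⊤ ∷ []))
  cone-apex Σc≡n = cone-join empty-face (empty-face∈Δ Σc≡n)

  -- Each face of Δ_{c ∷ʳ 0} is a face σ of Δ_c (the trailing 0 was merged
  -- into the last block) or σ * apex (the trailing 0 is an empty last block).
  cone-covered : ∀ (τ : Face n) → Δ (c ∷ʳ 0) τ → ∃ λ σ → Δ c σ ×
                   ((vertices τ ≐ vertices σ) ⊎ (vertices τ ≐ (⊤ ∷ vertices σ)))
  cone-covered τ@(Bs , o) k with lastZero k c refl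
  ... | absorbed l = τ , l , inj₁ (↭⇒≐ ↭-refl)
  ... | own-run d e l with Bs′ , refl , refl ← type≡∷ʳ0 Bs d e =
    (Bs′ , o′) , l , inj₂ (vertices-∷ʳ ⊥ o′)
    where
      Bs′≢[] : Bs′ ≢ []
      Bs′≢[] refl = ≼-nonempty l c≢[] refl
      o′ : IsOSP Bs′
      o′ = IsOSP-∷ʳ⊥⁻ Bs′≢[] (positive⇒nonempty (≼-positive l c-pos)) o

lemma4p1 : (n : ℕ) (c′ : List ℕ) → ¬ (c′ ≡ []) →
           PointedComposition n (c′ ++ 0 ∷ []) →
           IsConeOver {n} (Δ (c′ ++ 0 ∷ [])) (Δ c′) ⊤
lemma4p1 n c′ c′≢[] pc = record
  { apex-vertex = cone-apex Σc′≡n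
  ; apex-notin  = cone-apex-notin
  ; L⊆K         = λ _ l → ≼-absorb0 l c′≢[]
  ; join        = cone-join
  ; covered     = cone-covered
  }
  where
    c′-pos : All (1 ≤_) c′
    c′-pos = proj₁ (pointed-∷ʳ0 n c′ pc)
    Σc′≡n : sum c′ ≡ n
    Σc′≡n = proj₂ (pointed-∷ʳ0 n c′ pc)
    open Cone {n} c′ c′≢[] c′-pos
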